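{- Every short $p$-chain (with $p\ge3$) admits a $4/3$-approximate tour set.
   Context: Instance of splittable Capacitated Vehicle Routing on a tree $T$ rooted at the depot $r$, edge lengths $l(e)\ge0$, vertex demands $d(v)\ge0$, demands scaled so that vehicle capacity is $Q=1$. A tour is a closed walk from $r$ covering at most $1$ unit of demand, only at vertices it visits; demand may be split among tours. An edge $(u,v)$ means $u$ is the parent of $v$; $T_v$ is the subtree rooted at $v$, $d(T_v)$ its total demand; $P[u,v]$ the tree path, $l(P[u,v])$ its length. Traffic $f((u,v))=\lceil d(T_v)\rceil$; $LB=\sum_e 2l(e)f(e)$ for the current demands. A nonempty set of tours is a $4/3$-approximate tour set if its total length is at most $4/3$ times the reduction of $LB$ obtained by removing the demand it covers; a branch "admits" such a set if one exists covering demand of the branch. If $v$ has parent $u$, $T_v\cup\{(u,v)\}$ is a branch at $u$ with stem $(u,v)$; a $p$-branch if $f((u,v))=p$. Simplified: no internal vertex has positive demand, no non-root vertex has degree two, every leaf has demand strictly between $0$ and $1$, and none of the following is applicable: (condense) an edge $(u,v)$ with traffic $1$ and $v$ not a leaf; (unzip) an edge $(u,v)$ whose traffic equals the sum of traffics of all edges from $v$ to its children; (group) a vertex with at least four children, three of them leaves $v_1,v_2,v_3$ with $1.5<d(v_1)+d(v_2)+d(v_3)<2$; (unite) a vertex with two leaf children $v_1,v_2$ with $d(v_1)+d(v_2)\le1$; (slide) an edge $(u,v)$ and child edges $(v,w_1),(v,w_2)$ with $f((u,v))=f((v,w_1))$. A branch is simplified if these conditions hold within it. A 2-chain is a simplified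 2-branch with stem $(u,v)$ where $v$ has exactly three children, all leaves, with total demand in $(1.5,2]$. For $p\ge3$ a $p$-chain is a simplified $p$-branch with stem $(u,v)$ where $v$ has exactly three children $w_1,w_2,w_3$, $w_2,w_3$ leaves with $1<d(w_2)+d(w_3)\le1.5$, and $(v,w_1)$ the stem of a $(p-1)$-chain. Such a $p$-chain is short if $\min\{l((v,w_2)),l((v,w_3))\}\ge l(P[v,r])$. -}

module Defs where

open import Data.Nat using (ℕ; zero; suc)
import Data.Nat as N
open import Data.Fin using (Fin; zero; suc; toℕ; _≟_)
open import Data.Bool using (Bool; true; false; if_then_else_; _∨_)
open import Data.Product using (Σ; ∃; _×_; _,_)
open import Data.Sum using (_⊎_)
open import Data.Empty using (⊥)
open import Data.List using (List; []; _∷_)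
open import Relation.Nullary using (¬_)
open import Relation.Nullary.Decidable using (⌊_⌋)
open import Relation.Binary.PropositionalEquality using (_≡_)

-- The real numbers, axiomatised as a complete ordered field
-- (categorical: any model is isomorphic to ℝ).  The ceiling function on
-- nonnegative reals is included as a (uniquely determined) extra field.

record CompleteOrderedField : Set₁ where
  infixl 6 _+ᴿ_
  infixl 7 _*ᴿ_
  infix 8 -ᴿ_
  infix 4 _≤ᴿ_
  field
    R : Set
    0ᴿ 1ᴿ : R
    _+ᴿ_ _*ᴿ_ : R → R → R
    -ᴿ_ : R → R
    _≤ᴿ_ : R → R → Set
    +-assoc : ∀ x y z → (x +ᴿ y) +ᴿ z ≡ x +ᴿ (y +ᴿ z)
    +-comm : ∀ x y → x +ᴿ y ≡ y +ᴿ x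
    +-identityˡ : ∀ x → 0ᴿ +ᴿ x ≡ x
    -‿inverseˡ : ∀ x → (-ᴿ x) +ᴿ x ≡ 0ᴿ
    *-assoc : ∀ x y z → (x *ᴿ y) *ᴿ z ≡ x *ᴿ (y *ᴿ z)
    *-comm : ∀ x y → x *ᴿ y ≡ y *ᴿ x
    *-identityˡ : ∀ x → 1ᴿ *ᴿ x ≡ x
    distribˡ : ∀ x y z → x *ᴿ (y +ᴿ z) ≡ (x *ᴿ y) +ᴿ (x *ᴿ z)
    0≢1 : ¬ (0ᴿ ≡ 1ᴿ)
    *-inverse : ∀ x → ¬ (x ≡ 0ᴿ) → ∃ λ y → y *ᴿ x ≡ 1ᴿ
    ≤-refl : ∀ x → x ≤ᴿ x
    ≤-trans : ∀ {x y z} → x ≤ᴿ y → y ≤ᴿ z → x ≤ᴿ z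
    ≤-antisym : ∀ {x y} → x ≤ᴿ y → y ≤ᴿ x → x ≡ y
    ≤-total : ∀ x y → x ≤ᴿ y ⊎ y ≤ᴿ x
    +-monoˡ-≤ : ∀ {x y} z → x ≤ᴿ y → x +ᴿ z ≤ᴿ y +ᴿ z
    *-nonneg : ∀ {x y} → 0ᴿ ≤ᴿ x → 0ᴿ ≤ᴿ y → 0ᴿ ≤ᴿ x *ᴿ y
    sup : (S : R → Set) → (∃ λ x → S x) → (∃ λ b → ∀ x → S x → x ≤ᴿ b) →
          ∃ λ s → (∀ x → S x → x ≤ᴿ s) × (∀ b → (∀ x → S x → x ≤ᴿ b) → s ≤ᴿ b)
    ι : ℕ → R
    ι-zero : ι zero ≡ 0ᴿ
    ι-suc : ∀ k → ι (suc k) ≡ 1ᴿ +ᴿ ι k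
    ceil : R → ℕ
    ceil-spec : ∀ x → 0ᴿ ≤ᴿ x → x ≤ᴿ ι (ceil x) × ¬ (x +ᴿ 1ᴿ ≤ᴿ ι (ceil x))

  infix 4 _<ᴿ_
  _<ᴿ_ : R → R → Set
  x <ᴿ y = ¬ (y ≤ᴿ x)

  _-ᴿ_ : R → R → R
  x -ᴿ y = x +ᴿ (-ᴿ y)

-- The tree has vertex set Fin (suc n); vertex zero is the depot r.
-- Non-root vertex (suc i) has parent (par i); edges are indexed by Fin n,
-- edge i being (par i , suc i).  Acyclicity is ensured by the hypothesis
-- toℕ (par i) ≤ toℕ i (parents are numbered before children), which is
-- assumed in the theorem.

module Inst (F : CompleteOrderedField) (n : ℕ) (par : Fin n → Fin (suc n)) where
  open CompleteOrderedField F

  V : Set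
  V = Fin (suc n)

  root : V
  root = zero

  parentV : V → V
  parentV zero = zero
  parentV (suc i) = par i

  ∑ : ∀ {m} → (Fin m → R) → R
  ∑ {zero} f = 0ᴿ
  ∑ {suc m} f = f zero +ᴿ ∑ (λ i → f (suc i))

  ∑ℕ : ∀ {m} → (Fin m → ℕ) → ℕ
  ∑ℕ {zero} f = 0
  ∑ℕ {suc m} f = f zero N.+ ∑ℕ (λ i → f (suc i))

  -- w ∈ T_v : v is reached from w by iterating the parent map
  -- (at most n steps suffice since the depth is at most n)
  descWithin : ℕ → V → V → Bool
  descWithin zero v w = ⌊ w ≟ v ⌋
  descWithin (suc k) v w = ⌊ w ≟ v ⌋ ∨ descWithin k v (parentV w)

  isDesc : V → V → Bool
  isDesc v w = descWithin n v w

  InT : V → V → Set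
  InT v w = isDesc v w ≡ true

  dT : (V → R) → V → R
  dT d v = ∑ (λ w → if isDesc v w then d w else 0ᴿ)

  traffic : (V → R) → Fin n → ℕ
  traffic d i = ceil (dT d (suc i))

  LB : (Fin n → R) → (V → R) → R
  LB l d = ∑ (λ i → (ι 2 *ᴿ l i) *ᴿ ι (traffic d i))

  pathLen : (Fin n → R) → V → R
  pathLen l v = ∑ (λ i → if isDesc (suc i) v then l i else 0ᴿ)

  Leaf : V → Set
  Leaf x = ∀ i → ¬ (par i ≡ x)

  childTraffic : (V → R) → V → ℕ
  childTraffic d x = ∑ℕ (λ i → if ⌊ par i ≟ x ⌋ then traffic d i else 0)

  -- The branch with stem e (i.e. T_(suc e) ∪ {(par e , suc e)}) is simplified

  record Simplified (d : V → R) (e : Fin n) : Set where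
    field
      internal-zero : ∀ w → InT (suc e) w → (∃ λ i → par i ≡ w) → d w ≡ 0ᴿ
      no-deg2 : ∀ w → InT (suc e) w →
                ¬ (∃ λ i → par i ≡ w × (∀ j → par j ≡ w → j ≡ i))
      leaf-demand : ∀ w → InT (suc e) w → Leaf w → (0ᴿ <ᴿ d w) × (d w <ᴿ 1ᴿ)
      no-condense : ∀ i → InT (suc e) (suc i) → traffic d i ≡ 1 → Leaf (suc i)
      no-unzip : ∀ i → InT (suc e) (suc i) → ¬ (traffic d i ≡ childTraffic d (suc i))
      no-group : ∀ w → InT (suc e) w → ¬ (Σ (Fin n) λ i₁ → Σ (Fin n) λ i₂ → Σ (Fin n) λ i₃ → Σ (Fin n) λ i₄ →
                   ¬ (i₁ ≡ i₂) × ¬ (i₁ ≡ i₃) × ¬ (i₁ ≡ i₄) × ¬ (i₂ ≡ i₃) × ¬ (i₂ ≡ i₄) × ¬ (i₃ ≡ i₄) ×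
                   par i₁ ≡ w × par i₂ ≡ w × par i₃ ≡ w × par i₄ ≡ w ×
                   Leaf (suc i₁) × Leaf (suc i₂) × Leaf (suc i₃) ×
                   (ι 3 <ᴿ ι 2 *ᴿ (d (suc i₁) +ᴿ d (suc i₂) +ᴿ d (suc i₃))) ×
                   (d (suc i₁) +ᴿ d (suc i₂) +ᴿ d (suc i₃) <ᴿ ι 2))
      no-unite : ∀ w → InT (suc e) w → ¬ (Σ (Fin n) λ i₁ → Σ (Fin n) λ i₂ →
                   ¬ (i₁ ≡ i₂) × par i₁ ≡ w × par i₂ ≡ w ×
                   Leaf (suc i₁) × Leaf (suc i₂) × (d (suc i₁) +ᴿ d (suc i₂) ≤ᴿ 1ᴿ))
      no-slide : ∀ i → InT (suc e) (suc i) → ¬ (Σ (Fin n) λ j₁ → Σ (Fin n) λ j₂ →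
                   ¬ (j₁ ≡ j₂) × par j₁ ≡ suc i × par j₂ ≡ suc i × traffic d i ≡ traffic d j₁)

  ThreeChildren : Fin n → Fin n → Fin n → Fin n → Set
  ThreeChildren e i₁ i₂ i₃ =
    ¬ (i₁ ≡ i₂) × ¬ (i₁ ≡ i₃) × ¬ (i₂ ≡ i₃) ×
    par i₁ ≡ suc e × par i₂ ≡ suc e × par i₃ ≡ suc e ×
    (∀ j → par j ≡ suc e → j ≡ i₁ ⊎ j ≡ i₂ ⊎ j ≡ i₃)

  Chain : (d : V → R) → ℕ → Fin n → Set
  Chain d zero e = ⊥
  Chain d (suc zero) e = ⊥
  Chain d (suc (suc zero)) e =
    Simplified d e × traffic d e ≡ 2 ×
    Σ (Fin n) λ i₁ → Σ (Fin n) λ i₂ → Σ (Fin n) λ i₃ →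
      ThreeChildren e i₁ i₂ i₃ × Leaf (suc i₁) × Leaf (suc i₂) × Leaf (suc i₃) ×
      (ι 3 <ᴿ ι 2 *ᴿ (d (suc i₁) +ᴿ d (suc i₂) +ᴿ d (suc i₃))) ×
      (d (suc i₁) +ᴿ d (suc i₂) +ᴿ d (suc i₃) ≤ᴿ ι 2)
  Chain d (suc (suc (suc q))) e =
    Simplified d e × traffic d e ≡ suc (suc (suc q)) ×
    Σ (Fin n) λ i₁ → Σ (Fin n) λ i₂ → Σ (Fin n) λ i₃ →
      ThreeChildren e i₁ i₂ i₃ × Leaf (suc i₂) × Leaf (suc i₃) ×
      (1ᴿ <ᴿ d (suc i₂) +ᴿ d (suc i₃)) ×
      (ι 2 *ᴿ (d (suc i₂) +ᴿ d (suc i₃)) ≤ᴿ ι 3) ×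
      Chain d (suc (suc q)) i₁

  ShortChain : (l : Fin n → R) (d : V → R) → ℕ → Fin n → Set
  ShortChain l d (suc (suc (suc q))) e =
    Simplified d e × traffic d e ≡ suc (suc (suc q)) ×
    Σ (Fin n) λ i₁ → Σ (Fin n) λ i₂ → Σ (Fin n) λ i₃ →
      ThreeChildren e i₁ i₂ i₃ × Leaf (suc i₂) × Leaf (suc i₃) ×
      (1ᴿ <ᴿ d (suc i₂) +ᴿ d (suc i₃)) ×
      (ι 2 *ᴿ (d (suc i₂) +ᴿ d (suc i₃)) ≤ᴿ ι 3) ×
      Chain d (suc (suc q)) i₁ ×
      (pathLen l (suc e) ≤ᴿ l i₂) × (pathLen l (suc e) ≤ᴿ l i₃)
  ShortChain l d _ e = ⊥

  data Walk : V → V → Set where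
    stay : ∀ {x} → Walk x x
    down : ∀ {z} (i : Fin n) → Walk (suc i) z → Walk (par i) z
    up   : ∀ {z} (i : Fin n) → Walk (par i) z → Walk (suc i) z

  walkLen : (Fin n → R) → ∀ {x y} → Walk x y → R
  walkLen l stay = 0ᴿ
  walkLen l (down i w) = l i +ᴿ walkLen l w
  walkLen l (up i w) = l i +ᴿ walkLen l w

  Visits : ∀ {x y} → Walk x y → V → Set
  Visits {x} stay v = v ≡ x
  Visits {x} (down i w) v = v ≡ x ⊎ Visits w v
  Visits {x} (up i w) v = v ≡ x ⊎ Visits w v

  record Tour : Set where
    field
      walk : Walk root root
      amt : V → R
      amt-nonneg : ∀ v → 0ᴿ ≤ᴿ amt v
      amt-visited : ∀ v → ¬ (amt v ≡ 0ᴿ) → Visits walk v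
      amt-cap : ∑ amt ≤ᴿ 1ᴿ
  open Tour public

  covered : List Tour → V → R
  covered [] v = 0ᴿ
  covered (t ∷ ts) v = amt t v +ᴿ covered ts v

  totalLen : (Fin n → R) → List Tour → R
  totalLen l [] = 0ᴿ
  totalLen l (t ∷ ts) = walkLen l (walk t) +ᴿ totalLen l ts

  Approx43 : (l : Fin n → R) (d : V → R) → List Tour → Set
  Approx43 l d ts =
    ¬ (ts ≡ []) ×
    (∀ v → covered ts v ≤ᴿ d v) ×
    (0ᴿ <ᴿ ∑ (covered ts)) ×
    (ι 3 *ᴿ totalLen l ts ≤ᴿ ι 4 *ᴿ (LB l d -ᴿ LB l (λ v → d v -ᴿ covered ts v)))

  Admits : (l : Fin n → R) (d : V → R) → Fin n → Set
  Admits l d e = ∃ λ ts → Approx43 l d ts × (∀ v → ¬ (covered ts v ≡ 0ᴿ) → InT (suc e) v)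

module Submission where

open import Defs
open import Algebra.Bundles using (AbelianGroup)
open import Data.Bool using (Bool; true; false; if_then_else_; _∨_)
open import Data.Bool.Properties using (∨-zeroʳ)
open import Data.Empty using (⊥-elim)
open import Data.Fin using (Fin; zero; suc; toℕ; _≟_)
open import Data.Fin.Properties using (toℕ<n; suc-injective)
open import Data.List using (List; []; _∷_)
open import Data.Nat as ℕ using (ℕ; zero; suc; z≤n; s≤s; _≤_)
import Data.Nat.Properties as ℕ
open import Data.Product using (_×_; _,_; proj₁; proj₂)
open import Data.Sum using (_⊎_; inj₁; inj₂)
open import Function using (_∘_)
open import Relation.Binary.Bundles using (Poset)
open import Relation.Binary.PropositionalEquality
  using (_≡_; refl; sym; trans; cong; cong₂; subst; isEquivalence; module ≡-Reasoning)
import Relation.Binary.Reasoning.PartialOrder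
open import Relation.Nullary using (¬_; Dec; yes; no; does)
open import Relation.Nullary.Decidable using (⌊_⌋; dec-true; dec-false; isYes≗does)

-- Let v be the head of the stem, w₂ and w₃ its two leaf children and P = l(P[v,r]).  Serve each of
-- w₂, w₃ completely by its own round trip from r; the two tours cost 2(P + l₂) + 2(P + l₃).  Since
-- d(w₂) + d(w₃) > 1, removing this demand lowers the traffic of every edge of P[v,r] by at least one
-- and empties both leaf edges, so LB drops by at least 2P + 2l₂ + 2l₃.  Shortness, P ≤ l₂ and P ≤ l₃,
-- gives 3(4P + 2l₂ + 2l₃) ≤ 4(2P + 2l₂ + 2l₃).

module OrderedFieldProperties (F : CompleteOrderedField) where
  open CompleteOrderedField F

  +-identityʳ : ∀ x → x +ᴿ 0ᴿ ≡ x
  +-identityʳ x = trans (+-comm x 0ᴿ) (+-identityˡ x)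

  -‿inverseʳ : ∀ x → x -ᴿ x ≡ 0ᴿ
  -‿inverseʳ x = trans (+-comm x (-ᴿ x)) (-‿inverseˡ x)

  +-abelianGroup : AbelianGroup _ _
  +-abelianGroup = record
    { isAbelianGroup = record
      { isGroup = record
        { isMonoid = record
          { isSemigroup = record
            { isMagma = record { isEquivalence = isEquivalence ; ∙-cong = cong₂ _+ᴿ_ }
            ; assoc = +-assoc }
          ; identity = +-identityˡ , +-identityʳ }
        ; inverse = -‿inverseˡ , -‿inverseʳ
        ; ⁻¹-cong = cong (λ x → -ᴿ x) }
      ; comm = +-comm } }

  open AbelianGroup +-abelianGroup public using (group; monoid; commutativeMonoid; commutativeSemigroup)
  open import Algebra.Properties.Group group public
    using (identityʳ-unique; inverseˡ-unique; ⁻¹-involutive; //-rightDividesˡ; //-rightDividesʳ)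
  open import Algebra.Properties.CommutativeSemigroup commutativeSemigroup public using (interchange)
  open import Algebra.Properties.Monoid.Mult monoid public using (×-homo-+) renaming (_×_ to _×ᴿ_)

  *-zeroʳ : ∀ x → x *ᴿ 0ᴿ ≡ 0ᴿ
  *-zeroʳ x = identityʳ-unique (x *ᴿ 0ᴿ) (x *ᴿ 0ᴿ)
    (trans (sym (distribˡ x 0ᴿ 0ᴿ)) (cong (x *ᴿ_) (+-identityˡ 0ᴿ)))

  *-zeroˡ : ∀ x → 0ᴿ *ᴿ x ≡ 0ᴿ
  *-zeroˡ x = trans (*-comm 0ᴿ x) (*-zeroʳ x)

  distribʳ : ∀ x y z → (y +ᴿ z) *ᴿ x ≡ (y *ᴿ x) +ᴿ (z *ᴿ x)
  distribʳ x y z = trans (*-comm (y +ᴿ z) x) (trans (distribˡ x y z) (cong₂ _+ᴿ_ (*-comm x y) (*-comm x z)))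

  ι*≡× : ∀ k x → ι k *ᴿ x ≡ k ×ᴿ x
  ι*≡× zero x = trans (cong (_*ᴿ x) ι-zero) (*-zeroˡ x)
  ι*≡× (suc k) x = trans (cong (_*ᴿ x) (ι-suc k))
    (trans (distribʳ x 1ᴿ (ι k)) (cong₂ _+ᴿ_ (*-identityˡ x) (ι*≡× k x)))

  ι-1 : ι 1 ≡ 1ᴿ
  ι-1 = trans (ι-suc 0) (trans (cong (1ᴿ +ᴿ_) ι-zero) (+-identityʳ 1ᴿ))

  ≤-reflexive : ∀ {x y} → x ≡ y → x ≤ᴿ y
  ≤-reflexive {x} refl = ≤-refl x

  ≤-poset : Poset _ _ _
  ≤-poset = record
    { isPartialOrder = record
      { isPreorder = record { isEquivalence = isEquivalence ; reflexive = ≤-reflexive ; trans = ≤-trans }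
      ; antisym = ≤-antisym } }

  module ≤-Reasoning = Relation.Binary.Reasoning.PartialOrder ≤-poset

  ≤-resp₂ : ∀ {a b c d} → a ≡ c → b ≡ d → a ≤ᴿ b → c ≤ᴿ d
  ≤-resp₂ refl refl a≤b = a≤b

  +-monoʳ-≤ : ∀ {x y} z → x ≤ᴿ y → z +ᴿ x ≤ᴿ z +ᴿ y
  +-monoʳ-≤ {x} {y} z x≤y = ≤-resp₂ (+-comm x z) (+-comm y z) (+-monoˡ-≤ z x≤y)

  +-mono-≤ : ∀ {a b c d} → a ≤ᴿ b → c ≤ᴿ d → a +ᴿ c ≤ᴿ b +ᴿ d
  +-mono-≤ {b = b} {c = c} a≤b c≤d = ≤-trans (+-monoˡ-≤ c a≤b) (+-monoʳ-≤ b c≤d)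

  x≤x+y : ∀ {x y} → 0ᴿ ≤ᴿ y → x ≤ᴿ x +ᴿ y
  x≤x+y {x} 0≤y = ≤-resp₂ (+-identityʳ x) refl (+-monoʳ-≤ x 0≤y)

  +-nonneg : ∀ {x y} → 0ᴿ ≤ᴿ x → 0ᴿ ≤ᴿ y → 0ᴿ ≤ᴿ x +ᴿ y
  +-nonneg 0≤x 0≤y = ≤-trans 0≤x (x≤x+y 0≤y)

  x≤y⇒0≤y-x : ∀ {x y} → x ≤ᴿ y → 0ᴿ ≤ᴿ y -ᴿ x
  x≤y⇒0≤y-x {x} x≤y = ≤-resp₂ (-‿inverseʳ x) refl (+-monoˡ-≤ (-ᴿ x) x≤y)

  <⇒≤ : ∀ {x y} → x <ᴿ y → x ≤ᴿ y
  <⇒≤ {x} {y} x<y with ≤-total x y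
  ... | inj₁ x≤y = x≤y
  ... | inj₂ y≤x = ⊥-elim (x<y y≤x)

  <-≤-trans : ∀ {x y z} → x <ᴿ y → y ≤ᴿ z → x <ᴿ z
  <-≤-trans x<y y≤z z≤x = x<y (≤-trans y≤z z≤x)

  ≤-<-trans : ∀ {x y z} → x ≤ᴿ y → y <ᴿ z → x <ᴿ z
  ≤-<-trans x≤y y<z z≤x = y<z (≤-trans z≤x x≤y)

  -- A negative 1ᴿ would have the nonnegative square (-1)(-1) = 1.
  0≤1 : 0ᴿ ≤ᴿ 1ᴿ
  0≤1 with ≤-total 0ᴿ 1ᴿ
  ... | inj₁ 0≤1 = 0≤1
  ... | inj₂ 1≤0 = ⊥-elim (0≢1 (≤-antisym (≤-resp₂ refl square (*-nonneg 0≤-1 0≤-1)) 1≤0))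
    where
    0≤-1 : 0ᴿ ≤ᴿ -ᴿ 1ᴿ
    0≤-1 = ≤-resp₂ (-‿inverseʳ 1ᴿ) (+-identityˡ (-ᴿ 1ᴿ)) (+-monoˡ-≤ (-ᴿ 1ᴿ) 1≤0)
    square : (-ᴿ 1ᴿ) *ᴿ (-ᴿ 1ᴿ) ≡ 1ᴿ
    square = trans (inverseˡ-unique _ _ square-1) (⁻¹-involutive 1ᴿ)
      where
      open ≡-Reasoning
      square-1 : (-ᴿ 1ᴿ) *ᴿ (-ᴿ 1ᴿ) +ᴿ (-ᴿ 1ᴿ) ≡ 0ᴿ
      square-1 = begin
        (-ᴿ 1ᴿ) *ᴿ (-ᴿ 1ᴿ) +ᴿ (-ᴿ 1ᴿ)         ≡⟨ cong ((-ᴿ 1ᴿ) *ᴿ (-ᴿ 1ᴿ) +ᴿ_) (*-identityˡ (-ᴿ 1ᴿ)) ⟨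
        (-ᴿ 1ᴿ) *ᴿ (-ᴿ 1ᴿ) +ᴿ 1ᴿ *ᴿ (-ᴿ 1ᴿ)  ≡⟨ distribʳ (-ᴿ 1ᴿ) (-ᴿ 1ᴿ) 1ᴿ ⟨
        ((-ᴿ 1ᴿ) +ᴿ 1ᴿ) *ᴿ (-ᴿ 1ᴿ)            ≡⟨ cong (_*ᴿ (-ᴿ 1ᴿ)) (-‿inverseˡ 1ᴿ) ⟩
        0ᴿ *ᴿ (-ᴿ 1ᴿ)                         ≡⟨ *-zeroˡ (-ᴿ 1ᴿ) ⟩
        0ᴿ                                    ∎

  ×ᴿ-nonneg : ∀ k {x} → 0ᴿ ≤ᴿ x → 0ᴿ ≤ᴿ k ×ᴿ x
  ×ᴿ-nonneg zero 0≤x = ≤-refl 0ᴿ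
  ×ᴿ-nonneg (suc k) 0≤x = +-nonneg 0≤x (×ᴿ-nonneg k 0≤x)

  ×ᴿ-monoʳ : ∀ k {x y} → x ≤ᴿ y → k ×ᴿ x ≤ᴿ k ×ᴿ y
  ×ᴿ-monoʳ zero x≤y = ≤-refl 0ᴿ
  ×ᴿ-monoʳ (suc k) x≤y = +-mono-≤ x≤y (×ᴿ-monoʳ k x≤y)

  ×ᴿ-monoˡ : ∀ {m n x} → 0ᴿ ≤ᴿ x → m ℕ.≤ n → m ×ᴿ x ≤ᴿ n ×ᴿ x
  ×ᴿ-monoˡ {m} {n} {x} 0≤x m≤n = begin
    m ×ᴿ x                    ≤⟨ x≤x+y (×ᴿ-nonneg (n ℕ.∸ m) 0≤x) ⟩
    m ×ᴿ x +ᴿ (n ℕ.∸ m) ×ᴿ x  ≡⟨ ×-homo-+ x m (n ℕ.∸ m) ⟨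
    (m ℕ.+ (n ℕ.∸ m)) ×ᴿ x    ≡⟨ cong (_×ᴿ x) (ℕ.m+[n∸m]≡n m≤n) ⟩
    n ×ᴿ x                    ∎
    where open ≤-Reasoning

  ι≡×ᴿ1 : ∀ k → ι k ≡ k ×ᴿ 1ᴿ
  ι≡×ᴿ1 k = trans (sym (trans (*-comm (ι k) 1ᴿ) (*-identityˡ (ι k)))) (ι*≡× k 1ᴿ)

  ι-mono : ∀ {m n} → m ℕ.≤ n → ι m ≤ᴿ ι n
  ι-mono {m} {n} m≤n = ≤-resp₂ (sym (ι≡×ᴿ1 m)) (sym (ι≡×ᴿ1 n)) (×ᴿ-monoˡ 0≤1 m≤n)

  ι-nonneg : ∀ k → 0ᴿ ≤ᴿ ι k
  ι-nonneg k = ≤-resp₂ ι-zero refl (ι-mono z≤n)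

  ι-cancel-< : ∀ {m n} → ι m <ᴿ ι n → m ℕ.< n
  ι-cancel-< {m} {n} ιm<ιn with m ℕ.<? n
  ... | yes m<n = m<n
  ... | no m≮n = ⊥-elim (ιm<ιn (ι-mono (ℕ.≮⇒≥ m≮n)))

  ceil-mono : ∀ {x y} → 0ᴿ ≤ᴿ x → x ≤ᴿ y → ceil x ℕ.≤ ceil y
  ceil-mono {x} {y} 0≤x x≤y = ℕ.≤-pred (ι-cancel-< (<-≤-trans (proj₂ (ceil-spec x 0≤x)) x+1≤ι[1+⌈y⌉]))
    where
    open ≤-Reasoning
    x+1≤ι[1+⌈y⌉] : x +ᴿ 1ᴿ ≤ᴿ ι (suc (ceil y))
    x+1≤ι[1+⌈y⌉] = begin
      x +ᴿ 1ᴿ             ≤⟨ +-monoˡ-≤ 1ᴿ (≤-trans x≤y (proj₁ (ceil-spec y (≤-trans 0≤x x≤y)))) ⟩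
      ι (ceil y) +ᴿ 1ᴿ    ≡⟨ +-comm (ι (ceil y)) 1ᴿ ⟩
      1ᴿ +ᴿ ι (ceil y)    ≡⟨ ι-suc (ceil y) ⟨
      ι (suc (ceil y))    ∎

  ceil-< : ∀ {x y} → 0ᴿ ≤ᴿ y → ι (ceil x) <ᴿ y → ceil x ℕ.< ceil y
  ceil-< {y = y} 0≤y ι⌈x⌉<y = ι-cancel-< (<-≤-trans ι⌈x⌉<y (proj₁ (ceil-spec y 0≤y)))

  ceil-0 : ceil 0ᴿ ≡ 0
  ceil-0 = ℕ.n<1⇒n≡0 (ι-cancel-< (<-≤-trans (proj₂ (ceil-spec 0ᴿ (≤-refl 0ᴿ))) 0+1≤ι1))
    where
    0+1≤ι1 : 0ᴿ +ᴿ 1ᴿ ≤ᴿ ι 1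
    0+1≤ι1 = ≤-reflexive (trans (+-identityˡ 1ᴿ) (sym ι-1))

  ceil-drop : ∀ {x y s} → 0ᴿ ≤ᴿ y → 1ᴿ <ᴿ s → y +ᴿ s ≤ᴿ x → ceil y ℕ.< ceil x
  ceil-drop {x} {y} {s} 0≤y 1<s y+s≤x =
    ceil-< (≤-trans 0≤y y≤x) (<-≤-trans (proj₂ (ceil-spec y 0≤y)) (≤-trans (+-monoʳ-≤ y (<⇒≤ 1<s)) y+s≤x))
    where
    y≤x : y ≤ᴿ x
    y≤x = ≤-trans (x≤x+y (≤-trans 0≤1 (<⇒≤ 1<s))) y+s≤x

  ceil-0<ceil : ∀ {x} → 0ᴿ <ᴿ x → ceil 0ᴿ ℕ.< ceil x
  ceil-0<ceil 0<x = ceil-< (<⇒≤ 0<x) (≤-<-trans (≤-reflexive (trans (cong ι ceil-0) ι-zero)) 0<x)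

  *ι-drop : ∀ {c m k n} → 0ᴿ ≤ᴿ c → k ℕ.+ m ℕ.≤ n → c *ᴿ ι m +ᴿ k ×ᴿ c ≤ᴿ c *ᴿ ι n
  *ι-drop {c} {m} {k} {n} 0≤c k+m≤n = begin
    c *ᴿ ι m +ᴿ k ×ᴿ c  ≡⟨ cong (_+ᴿ k ×ᴿ c) (c*ι≡× m) ⟩
    m ×ᴿ c +ᴿ k ×ᴿ c    ≡⟨ +-comm (m ×ᴿ c) (k ×ᴿ c) ⟩
    k ×ᴿ c +ᴿ m ×ᴿ c    ≡⟨ ×-homo-+ c k m ⟨
    (k ℕ.+ m) ×ᴿ c      ≤⟨ ×ᴿ-monoˡ 0≤c k+m≤n ⟩
    n ×ᴿ c              ≡⟨ c*ι≡× n ⟨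
    c *ᴿ ι n            ∎
    where
    open ≤-Reasoning
    c*ι≡× : ∀ j → c *ᴿ ι j ≡ j ×ᴿ c
    c*ι≡× j = trans (*-comm c (ι j)) (ι*≡× j c)

  edge-term-drop : ∀ {x g m n} → 0ᴿ ≤ᴿ x → (g ≡ x × suc m ℕ.≤ n) ⊎ (g ≡ 0ᴿ × m ℕ.≤ n) →
                   (ι 2 *ᴿ x) *ᴿ ι m +ᴿ (g +ᴿ g) ≤ᴿ (ι 2 *ᴿ x) *ᴿ ι n
  edge-term-drop {x} {m = m} 0≤x (inj₁ (refl , 1+m≤n)) =
    ≤-resp₂ (cong ((ι 2 *ᴿ x) *ᴿ ι m +ᴿ_) 1×ι2x≡x+x) refl
            (*ι-drop {k = 1} (*-nonneg (ι-nonneg 2) 0≤x) 1+m≤n)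
    where
    1×ι2x≡x+x : 1 ×ᴿ (ι 2 *ᴿ x) ≡ x +ᴿ x
    1×ι2x≡x+x = trans (+-identityʳ _) (trans (ι*≡× 2 x) (cong (x +ᴿ_) (+-identityʳ x)))
  edge-term-drop {x} {m = m} 0≤x (inj₂ (refl , m≤n)) =
    ≤-resp₂ (cong ((ι 2 *ᴿ x) *ᴿ ι m +ᴿ_) (sym (+-identityˡ 0ᴿ))) refl
            (*ι-drop {k = 0} (*-nonneg (ι-nonneg 2) 0≤x) m≤n)

  x+y≤z⇒y≤z-x : ∀ {x y z} → x +ᴿ y ≤ᴿ z → y ≤ᴿ z -ᴿ x
  x+y≤z⇒y≤z-x {x} {y} x+y≤z = ≤-resp₂ (trans (cong (_-ᴿ x) (+-comm x y)) (//-rightDividesʳ x y)) refl (+-monoˡ-≤ (-ᴿ x) x+y≤z)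

  3[2[a+P]+2[b+P]]≤4[2[P+a+b]] : ∀ {P a b} → P ≤ᴿ a → P ≤ᴿ b →
    3 ×ᴿ (((a +ᴿ P) +ᴿ (a +ᴿ P)) +ᴿ ((b +ᴿ P) +ᴿ (b +ᴿ P))) ≤ᴿ 4 ×ᴿ ((P +ᴿ (a +ᴿ b)) +ᴿ (P +ᴿ (a +ᴿ b)))
  3[2[a+P]+2[b+P]]≤4[2[P+a+b]] {P} {a} {b} P≤a P≤b = begin
    3 ×ᴿ (((a +ᴿ P) +ᴿ (a +ᴿ P)) +ᴿ ((b +ᴿ P) +ᴿ (b +ᴿ P)))
      ≡⟨ solve 3 (λ P a b → 3 ⊗ (((a ⊕ P) ⊕ (a ⊕ P)) ⊕ ((b ⊕ P) ⊕ (b ⊕ P)))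
                            ⊜ (8 ⊗ P ⊕ (6 ⊗ a ⊕ 6 ⊗ b)) ⊕ ((P ⊕ P) ⊕ (P ⊕ P))) refl P a b ⟩
    common +ᴿ ((P +ᴿ P) +ᴿ (P +ᴿ P))
      ≤⟨ +-monoʳ-≤ common (+-mono-≤ (+-mono-≤ P≤a P≤a) (+-mono-≤ P≤b P≤b)) ⟩
    common +ᴿ ((a +ᴿ a) +ᴿ (b +ᴿ b))
      ≡⟨ solve 3 (λ P a b → (8 ⊗ P ⊕ (6 ⊗ a ⊕ 6 ⊗ b)) ⊕ ((a ⊕ a) ⊕ (b ⊕ b))
                            ⊜ 4 ⊗ ((P ⊕ (a ⊕ b)) ⊕ (P ⊕ (a ⊕ b)))) refl P a b ⟩
    4 ×ᴿ ((P +ᴿ (a +ᴿ b)) +ᴿ (P +ᴿ (a +ᴿ b)))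
      ∎
    where
    open ≤-Reasoning
    open import Algebra.Solver.CommutativeMonoid commutativeMonoid using (Expr; _⊕_; id; _⊜_; solve)
    -- Mirrors _×ᴿ_, so ⟦ k ⊗ e ⟧ is definitionally k ×ᴿ ⟦ e ⟧.
    _⊗_ : ℕ → Expr 3 → Expr 3
    zero ⊗ e = id
    suc k ⊗ e = e ⊕ (k ⊗ e)
    common : R
    common = 8 ×ᴿ P +ᴿ (6 ×ᴿ a +ᴿ 6 ×ᴿ b)

module TreeProperties (F : CompleteOrderedField) (n : ℕ) (par : Fin (suc n) → Fin (suc (suc n)))
                      (par<child : ∀ i → toℕ (par i) ℕ.≤ toℕ i) where
  open CompleteOrderedField F
  open OrderedFieldProperties F
  open Inst F (suc n) par

  ∑-cong : ∀ {m} {f g : Fin m → R} → (∀ i → f i ≡ g i) → ∑ f ≡ ∑ g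
  ∑-cong {zero} f≗g = refl
  ∑-cong {suc m} f≗g = cong₂ _+ᴿ_ (f≗g zero) (∑-cong (λ i → f≗g (suc i)))

  ∑-zero : ∀ {m} {f : Fin m → R} → (∀ i → f i ≡ 0ᴿ) → ∑ f ≡ 0ᴿ
  ∑-zero {zero} f≗0 = refl
  ∑-zero {suc m} f≗0 = trans (cong₂ _+ᴿ_ (f≗0 zero) (∑-zero (λ i → f≗0 (suc i)))) (+-identityˡ 0ᴿ)

  ∑-distrib-+ : ∀ {m} (f g : Fin m → R) → ∑ (λ i → f i +ᴿ g i) ≡ ∑ f +ᴿ ∑ g
  ∑-distrib-+ {zero} f g = sym (+-identityˡ 0ᴿ)
  ∑-distrib-+ {suc m} f g =
    trans (cong (f zero +ᴿ g zero +ᴿ_) (∑-distrib-+ (λ i → f (suc i)) (λ i → g (suc i))))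
          (interchange (f zero) (g zero) _ _)

  ∑-mono : ∀ {m} {f g : Fin m → R} → (∀ i → f i ≤ᴿ g i) → ∑ f ≤ᴿ ∑ g
  ∑-mono {zero} f≤g = ≤-refl 0ᴿ
  ∑-mono {suc m} f≤g = +-mono-≤ (f≤g zero) (∑-mono (λ i → f≤g (suc i)))

  ∑-nonneg : ∀ {m} {f : Fin m → R} → (∀ i → 0ᴿ ≤ᴿ f i) → 0ᴿ ≤ᴿ ∑ f
  ∑-nonneg {zero} 0≤f = ≤-refl 0ᴿ
  ∑-nonneg {suc m} 0≤f = +-nonneg (0≤f zero) (∑-nonneg (λ i → 0≤f (suc i)))

  onlyIf : Bool → R → R
  onlyIf b x = if b then x else 0ᴿ

  onlyIf-nonneg : ∀ b {x} → 0ᴿ ≤ᴿ x → 0ᴿ ≤ᴿ onlyIf b x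
  onlyIf-nonneg true 0≤x = 0≤x
  onlyIf-nonneg false 0≤x = ≤-refl 0ᴿ

  onlyIf-mono : ∀ b {x y} → x ≤ᴿ y → onlyIf b x ≤ᴿ onlyIf b y
  onlyIf-mono true x≤y = x≤y
  onlyIf-mono false x≤y = ≤-refl 0ᴿ

  single : ∀ {m} → Fin m → R → Fin m → R
  single a x i = onlyIf (does (i ≟ a)) x

  single-≡ : ∀ {m} (a : Fin m) x → single a x a ≡ x
  single-≡ a x = cong (λ b → onlyIf b x) (dec-true (a ≟ a) refl)

  single-≢ : ∀ {m} {a i : Fin m} x → ¬ i ≡ a → single a x i ≡ 0ᴿ
  single-≢ {a = a} {i} x i≢a = cong (λ b → onlyIf b x) (dec-false (i ≟ a) i≢a)

  single-nonneg : ∀ {m} (a : Fin m) {x} → 0ᴿ ≤ᴿ x → ∀ i → 0ᴿ ≤ᴿ single a x i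
  single-nonneg a 0≤x i = onlyIf-nonneg (does (i ≟ a)) 0≤x

  ∑-single : ∀ {m} (a : Fin m) x → ∑ (single a x) ≡ x
  ∑-single {suc m} zero x =
    trans (cong₂ _+ᴿ_ (single-≡ {suc m} zero x) (∑-zero {m} λ i → single-≢ {a = zero} {suc i} x λ ()))
          (+-identityʳ x)
  ∑-single {suc m} (suc a) x =
    trans (cong₂ _+ᴿ_ (single-≢ {a = suc a} {zero} x λ ()) (∑-single a x)) (+-identityˡ x)

  ≤-∑ : ∀ {m} (f : Fin m → R) → (∀ i → 0ᴿ ≤ᴿ f i) → ∀ a → f a ≤ᴿ ∑ f
  ≤-∑ f 0≤f a = ≤-resp₂ (∑-single a (f a)) refl (∑-mono single≤f)
    where
    single≤f : ∀ i → single a (f a) i ≤ᴿ f i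
    single≤f i with i ≟ a
    ... | yes refl = ≤-refl (f i)
    ... | no _ = 0≤f i

  parentV-≤ : ∀ w → toℕ (parentV w) ℕ.≤ toℕ w
  parentV-≤ zero = z≤n
  parentV-≤ (suc j) = ℕ.m≤n⇒m≤1+n (par<child j)

  descWithin⇒≤ : ∀ k {v w} → descWithin k v w ≡ true → toℕ v ℕ.≤ toℕ w
  descWithin⇒≤ zero {v} {w} w∈Tv with w ≟ v
  descWithin⇒≤ zero w∈Tv | yes refl = ℕ.≤-refl
  descWithin⇒≤ zero () | no _
  descWithin⇒≤ (suc k) {v} {w} w∈Tv with w ≟ v
  ... | yes refl = ℕ.≤-refl
  ... | no _ = ℕ.≤-trans (descWithin⇒≤ k w∈Tv) (parentV-≤ w)

  descWithin-leaf : ∀ {v} → Leaf v → ∀ k {w} → descWithin k v w ≡ true → w ≡ v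
  descWithin-leaf {v} leaf zero {w} w∈Tv with w ≟ v
  descWithin-leaf leaf zero w∈Tv | yes w≡v = w≡v
  descWithin-leaf leaf zero () | no _
  descWithin-leaf {v} leaf (suc k) {w} w∈Tv with w ≟ v
  ... | yes w≡v = w≡v
  ... | no _ with w | descWithin-leaf leaf k w∈Tv
  ...   | zero | root≡v = root≡v
  ...   | suc j | par[j]≡v = ⊥-elim (leaf j par[j]≡v)

  -- Depth is at most the index, so k ≥ toℕ w steps of the parent map already reach the root.
  descWithin-stable : ∀ k {v} w → toℕ w ℕ.≤ k → descWithin (suc k) v w ≡ descWithin k v w
  descWithin-stable zero {v} zero _ with zero ≟ v
  ... | yes _ = refl
  ... | no _ = refl
  descWithin-stable (suc k) {v} w w≤1+k = cong (⌊ w ≟ v ⌋ ∨_) (descWithin-stable k (parentV w) (parentV≤k w w≤1+k))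
    where
    parentV≤k : ∀ w → toℕ w ℕ.≤ suc k → toℕ (parentV w) ℕ.≤ k
    parentV≤k zero _ = z≤n
    parentV≤k (suc j) (s≤s j≤k) = ℕ.≤-trans (par<child j) j≤k

  isDesc-suc : ∀ x j → isDesc x (suc j) ≡ (⌊ suc j ≟ x ⌋ ∨ isDesc x (par j))
  isDesc-suc x j = cong (⌊ suc j ≟ x ⌋ ∨_) (sym (descWithin-stable n (par j) par[j]≤n))
    where
    par[j]≤n : toℕ (par j) ℕ.≤ n
    par[j]≤n = ℕ.≤-trans (par<child j) (ℕ.≤-pred (toℕ<n j))

  isDesc-refl : ∀ x → isDesc x x ≡ true
  isDesc-refl x with x ≟ x
  ... | yes _ = refl
  ... | no x≢x = ⊥-elim (x≢x refl)

  isDesc-child : ∀ {x v} j → par j ≡ v → isDesc x v ≡ true → isDesc x (suc j) ≡ true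
  isDesc-child {x} j refl v∈Tx = trans (isDesc-suc x j) (trans (cong (⌊ suc j ≟ x ⌋ ∨_) v∈Tx) (∨-zeroʳ _))

  isDesc-par : ∀ j → isDesc (suc j) (par j) ≡ false
  isDesc-par j with isDesc (suc j) (par j) in par∈Tj
  ... | false = refl
  ... | true = ⊥-elim (ℕ.<⇒≱ (s≤s (par<child j)) (descWithin⇒≤ (suc n) par∈Tj))

  isDesc-root : ∀ i → isDesc (suc i) root ≡ false
  isDesc-root i with isDesc (suc i) root in root∈Ti
  ... | false = refl
  ... | true with () ← descWithin⇒≤ (suc n) {suc i} {root} root∈Ti

  isDesc-leaf : ∀ {v w} → Leaf v → isDesc v w ≡ true → w ≡ v
  isDesc-leaf leaf = descWithin-leaf leaf (suc n)

  pathLen-root : ∀ l → pathLen l root ≡ 0ᴿ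
  pathLen-root l = ∑-zero λ i → cong (λ b → onlyIf b (l i)) (isDesc-root i)

  pathLen-suc : ∀ l j → pathLen l (suc j) ≡ l j +ᴿ pathLen l (par j)
  pathLen-suc l j = begin
    pathLen l (suc j)
      ≡⟨ ∑-cong edgeSplit ⟩
    ∑ (λ i → single j (l j) i +ᴿ onlyIf (isDesc (suc i) (par j)) (l i))
      ≡⟨ ∑-distrib-+ (single j (l j)) (λ i → onlyIf (isDesc (suc i) (par j)) (l i)) ⟩
    ∑ (single j (l j)) +ᴿ pathLen l (par j)
      ≡⟨ cong (_+ᴿ pathLen l (par j)) (∑-single j (l j)) ⟩
    l j +ᴿ pathLen l (par j)
      ∎
    where
    open ≡-Reasoning
    edgeSplit : ∀ i → onlyIf (isDesc (suc i) (suc j)) (l i) ≡ single j (l j) i +ᴿ onlyIf (isDesc (suc i) (par j)) (l i)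
    edgeSplit i with i ≟ j
    ... | yes refl = begin
      onlyIf (isDesc (suc i) (suc i)) (l i)  ≡⟨ cong (λ b → onlyIf b (l i)) (isDesc-refl (suc i)) ⟩
      l i                                    ≡⟨ +-identityʳ (l i) ⟨
      l i +ᴿ 0ᴿ                              ≡⟨ cong (l i +ᴿ_) (cong (λ b → onlyIf b (l i)) (isDesc-par i)) ⟨
      l i +ᴿ onlyIf (isDesc (suc i) (par i)) (l i)  ∎
    ... | no i≢j = begin
      onlyIf (isDesc (suc i) (suc j)) (l i)                      ≡⟨ cong (λ b → onlyIf b (l i)) (isDesc-suc (suc i) j) ⟩
      onlyIf (⌊ suc j ≟ suc i ⌋ ∨ isDesc (suc i) (par j)) (l i)  ≡⟨ cong (λ b → onlyIf (b ∨ isDesc (suc i) (par j)) (l i)) j≠i ⟩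
      onlyIf (isDesc (suc i) (par j)) (l i)                      ≡⟨ +-identityˡ _ ⟨
      0ᴿ +ᴿ onlyIf (isDesc (suc i) (par j)) (l i)                ∎
      where
      j≠i : ⌊ suc j ≟ suc i ⌋ ≡ false
      j≠i = trans (isYes≗does (suc j ≟ suc i)) (dec-false (suc j ≟ suc i) (i≢j ∘ sym ∘ suc-injective))

  infixr 5 _++ᵂ_
  _++ᵂ_ : ∀ {x y z} → Walk x y → Walk y z → Walk x z
  stay ++ᵂ w = w
  down i w₁ ++ᵂ w = down i (w₁ ++ᵂ w)
  up i w₁ ++ᵂ w = up i (w₁ ++ᵂ w)

  walkLen-++ : ∀ l {x y z} (w₁ : Walk x y) (w₂ : Walk y z) → walkLen l (w₁ ++ᵂ w₂) ≡ walkLen l w₁ +ᴿ walkLen l w₂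
  walkLen-++ l stay w₂ = sym (+-identityˡ _)
  walkLen-++ l (down i w₁) w₂ = trans (cong (l i +ᴿ_) (walkLen-++ l w₁ w₂)) (sym (+-assoc (l i) _ _))
  walkLen-++ l (up i w₁) w₂ = trans (cong (l i +ᴿ_) (walkLen-++ l w₁ w₂)) (sym (+-assoc (l i) _ _))

  Visits-start : ∀ {x y} (w : Walk x y) → Visits w x
  Visits-start stay = refl
  Visits-start (down i w) = inj₁ refl
  Visits-start (up i w) = inj₁ refl

  Visits-++ʳ : ∀ {x y z} (w₁ : Walk x y) {w₂ : Walk y z} {v} → Visits w₂ v → Visits (w₁ ++ᵂ w₂) v
  Visits-++ʳ stay v∈w₂ = v∈w₂
  Visits-++ʳ (down i w₁) v∈w₂ = inj₂ (Visits-++ʳ w₁ v∈w₂)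
  Visits-++ʳ (up i w₁) v∈w₂ = inj₂ (Visits-++ʳ w₁ v∈w₂)

  -- The bound toℕ w ≤ k is fuel: the parent map strictly lowers the index.
  descend : ∀ k w → toℕ w ℕ.≤ k → Walk root w
  descend k zero _ = stay
  descend (suc k) (suc j) (s≤s j≤k) = descend k (par j) (ℕ.≤-trans (par<child j) j≤k) ++ᵂ down j stay

  ascend : ∀ k w → toℕ w ℕ.≤ k → Walk w root
  ascend k zero _ = stay
  ascend (suc k) (suc j) (s≤s j≤k) = up j (ascend k (par j) (ℕ.≤-trans (par<child j) j≤k))

  walkLen-descend : ∀ l k w w≤k → walkLen l (descend k w w≤k) ≡ pathLen l w
  walkLen-descend l k zero _ = sym (pathLen-root l)
  walkLen-descend l (suc k) (suc j) (s≤s j≤k) = begin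
    walkLen l (descend k (par j) _ ++ᵂ down j stay)        ≡⟨ walkLen-++ l (descend k (par j) _) (down j stay) ⟩
    walkLen l (descend k (par j) _) +ᴿ (l j +ᴿ 0ᴿ)         ≡⟨ cong₂ _+ᴿ_ (walkLen-descend l k (par j) _) (+-identityʳ (l j)) ⟩
    pathLen l (par j) +ᴿ l j                                ≡⟨ +-comm (pathLen l (par j)) (l j) ⟩
    l j +ᴿ pathLen l (par j)                                ≡⟨ pathLen-suc l j ⟨
    pathLen l (suc j)                                       ∎
    where open ≡-Reasoning

  walkLen-ascend : ∀ l k w w≤k → walkLen l (ascend k w w≤k) ≡ pathLen l w
  walkLen-ascend l k zero _ = sym (pathLen-root l)
  walkLen-ascend l (suc k) (suc j) (s≤s j≤k) =
    trans (cong (l j +ᴿ_) (walkLen-ascend l k (par j) _)) (sym (pathLen-suc l j))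

  roundTrip : V → Walk root root
  roundTrip w = descend (suc n) w w≤1+n ++ᵂ ascend (suc n) w w≤1+n
    where
    w≤1+n : toℕ w ℕ.≤ suc n
    w≤1+n = ℕ.≤-pred (toℕ<n w)

  walkLen-roundTrip : ∀ l w → walkLen l (roundTrip w) ≡ pathLen l w +ᴿ pathLen l w
  walkLen-roundTrip l w = trans (walkLen-++ l (descend (suc n) w _) (ascend (suc n) w _))
                                (cong₂ _+ᴿ_ (walkLen-descend l (suc n) w _) (walkLen-ascend l (suc n) w _))

  roundTrip-visits : ∀ w → Visits (roundTrip w) w
  roundTrip-visits w = Visits-++ʳ (descend (suc n) w _) (Visits-start (ascend (suc n) w _))

  directTour : (w : V) (x : R) → 0ᴿ ≤ᴿ x → x ≤ᴿ 1ᴿ → Tour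
  directTour w x 0≤x x≤1 = record
    { walk = roundTrip w
    ; amt = single w x
    ; amt-nonneg = single-nonneg w 0≤x
    ; amt-visited = visited
    ; amt-cap = ≤-resp₂ (sym (∑-single w x)) refl x≤1 }
    where
    visited : ∀ v → ¬ single w x v ≡ 0ᴿ → Visits (roundTrip w) v
    visited v x≢0 with v ≟ w
    ... | yes refl = roundTrip-visits v
    ... | no _ = ⊥-elim (x≢0 refl)

  module TwoLeafTours (l : Fin (suc n) → R) (d : V → R) (0≤l : ∀ i → 0ᴿ ≤ᴿ l i) (0≤d : ∀ u → 0ᴿ ≤ᴿ d u)
    {v : V} {i₂ i₃ : Fin (suc n)} (i₂≢i₃ : ¬ i₂ ≡ i₃) (par₂ : par i₂ ≡ v) (par₃ : par i₃ ≡ v)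
    (leaf₂ : Leaf (suc i₂)) (leaf₃ : Leaf (suc i₃))
    (d₂ : (0ᴿ <ᴿ d (suc i₂)) × (d (suc i₂) <ᴿ 1ᴿ)) (d₃ : (0ᴿ <ᴿ d (suc i₃)) × (d (suc i₃) <ᴿ 1ᴿ))
    (1<d₂+d₃ : 1ᴿ <ᴿ d (suc i₂) +ᴿ d (suc i₃)) where

    w₂ w₃ : V
    w₂ = suc i₂
    w₃ = suc i₃

    w₂≢w₃ : ¬ w₂ ≡ w₃
    w₂≢w₃ = i₂≢i₃ ∘ suc-injective

    tours : List Tour
    tours = directTour w₂ (d w₂) (0≤d w₂) (<⇒≤ (proj₂ d₂))
          ∷ directTour w₃ (d w₃) (0≤d w₃) (<⇒≤ (proj₂ d₃))
          ∷ []

    served : V → R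
    served = covered tours

    residual : V → R
    residual u = d u -ᴿ served u

    served-w₂ : served w₂ ≡ d w₂
    served-w₂ = trans (cong₂ _+ᴿ_ (single-≡ w₂ (d w₂)) (trans (+-identityʳ _) (single-≢ (d w₃) w₂≢w₃))) (+-identityʳ _)

    served-w₃ : served w₃ ≡ d w₃
    served-w₃ = trans (cong₂ _+ᴿ_ (single-≢ (d w₂) (w₂≢w₃ ∘ sym)) (trans (+-identityʳ _) (single-≡ w₃ (d w₃)))) (+-identityˡ _)

    served-elsewhere : ∀ {u} → ¬ u ≡ w₂ → ¬ u ≡ w₃ → served u ≡ 0ᴿ
    served-elsewhere u≢w₂ u≢w₃ =
      trans (cong₂ _+ᴿ_ (single-≢ (d w₂) u≢w₂) (trans (+-identityʳ _) (single-≢ (d w₃) u≢w₃))) (+-identityˡ 0ᴿ)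

    served≤d : ∀ u → served u ≤ᴿ d u
    served≤d u = byCases (u ≟ w₂) (u ≟ w₃)
      where
      byCases : Dec (u ≡ w₂) → Dec (u ≡ w₃) → served u ≤ᴿ d u
      byCases (yes refl) _ = ≤-reflexive served-w₂
      byCases (no _) (yes refl) = ≤-reflexive served-w₃
      byCases (no u≢w₂) (no u≢w₃) = ≤-resp₂ (sym (served-elsewhere u≢w₂ u≢w₃)) refl (0≤d u)

    ∑-served : ∑ served ≡ d w₂ +ᴿ d w₃
    ∑-served = begin
      ∑ served
        ≡⟨ ∑-distrib-+ (single w₂ (d w₂)) (λ u → single w₃ (d w₃) u +ᴿ 0ᴿ) ⟩
      ∑ (single w₂ (d w₂)) +ᴿ ∑ (λ u → single w₃ (d w₃) u +ᴿ 0ᴿ)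
        ≡⟨ cong₂ _+ᴿ_ (∑-single w₂ (d w₂)) (∑-cong λ u → +-identityʳ (single w₃ (d w₃) u)) ⟩
      d w₂ +ᴿ ∑ (single w₃ (d w₃))
        ≡⟨ cong (d w₂ +ᴿ_) (∑-single w₃ (d w₃)) ⟩
      d w₂ +ᴿ d w₃
        ∎
      where open ≡-Reasoning

    1<∑served : 1ᴿ <ᴿ ∑ served
    1<∑served = <-≤-trans 1<d₂+d₃ (≤-reflexive (sym ∑-served))

    served-nonneg : ∀ u → 0ᴿ ≤ᴿ served u
    served-nonneg u = +-nonneg (single-nonneg w₂ (0≤d w₂) u) (+-nonneg (single-nonneg w₃ (0≤d w₃) u) (≤-refl 0ᴿ))

    residual-nonneg : ∀ u → 0ᴿ ≤ᴿ residual u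
    residual-nonneg u = x≤y⇒0≤y-x (served≤d u)

    residual≤d : ∀ u → residual u ≤ᴿ d u
    residual≤d u = ≤-resp₂ refl (//-rightDividesˡ (served u) (d u)) (x≤x+y (served-nonneg u))

    dT-residual-nonneg : ∀ x → 0ᴿ ≤ᴿ dT residual x
    dT-residual-nonneg x = ∑-nonneg λ u → onlyIf-nonneg (isDesc x u) (residual-nonneg u)

    traffic-residual-≤ : ∀ i → traffic residual i ℕ.≤ traffic d i
    traffic-residual-≤ i =
      ceil-mono (dT-residual-nonneg (suc i)) (∑-mono λ u → onlyIf-mono (isDesc (suc i) u) (residual≤d u))

    dT-split : ∀ x → isDesc x w₂ ≡ true → isDesc x w₃ ≡ true → dT d x ≡ dT residual x +ᴿ ∑ served
    dT-split x w₂∈Tx w₃∈Tx = trans (∑-cong split) (∑-distrib-+ (λ u → onlyIf (isDesc x u) (residual u)) served)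
      where
      split : ∀ u → onlyIf (isDesc x u) (d u) ≡ onlyIf (isDesc x u) (residual u) +ᴿ served u
      split u with isDesc x u in u∈Tx
      ... | true = sym (//-rightDividesˡ (served u) (d u))
      ... | false = sym (trans (+-identityˡ _) (served-elsewhere (outside w₂∈Tx) (outside w₃∈Tx)))
        where
        outside : ∀ {w} → isDesc x w ≡ true → ¬ u ≡ w
        outside w∈Tx refl with () ← trans (sym w∈Tx) u∈Tx

    traffic-drop-onPath : ∀ i → isDesc (suc i) v ≡ true → suc (traffic residual i) ℕ.≤ traffic d i
    traffic-drop-onPath i v∈Ti = ceil-drop (dT-residual-nonneg (suc i)) 1<∑served
      (≤-reflexive (sym (dT-split (suc i) (isDesc-child i₂ par₂ v∈Ti) (isDesc-child i₃ par₃ v∈Ti))))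

    traffic-drop-leaf : ∀ {j} → Leaf (suc j) → 0ᴿ <ᴿ d (suc j) → served (suc j) ≡ d (suc j) →
                        suc (traffic residual j) ℕ.≤ traffic d j
    traffic-drop-leaf {j} leaf 0<d served≡d =
      subst (λ y → ceil y ℕ.< traffic d j) (sym dT-residual≡0) (ceil-0<ceil (<-≤-trans 0<d d≤dT))
      where
      dT-residual≡0 : dT residual (suc j) ≡ 0ᴿ
      dT-residual≡0 = ∑-zero emptied
        where
        emptied : ∀ u → onlyIf (isDesc (suc j) u) (residual u) ≡ 0ᴿ
        emptied u with isDesc (suc j) u in u∈Tj
        ... | false = refl
        ... | true with refl ← isDesc-leaf leaf u∈Tj = trans (cong (λ s → d u -ᴿ s) served≡d) (-‿inverseʳ (d u))
      d≤dT : d (suc j) ≤ᴿ dT d (suc j)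
      d≤dT = ≤-resp₂ (cong (λ b → onlyIf b (d (suc j))) (isDesc-refl (suc j))) refl
                      (≤-∑ _ (λ u → onlyIf-nonneg (isDesc (suc j) u) (0≤d u)) (suc j))

    P : R
    P = pathLen l v

    -- Half of the guaranteed decrease of the LB summand 2 l(i) f(i) of edge i.
    saving : Fin (suc n) → R
    saving i = onlyIf (isDesc (suc i) v) (l i) +ᴿ (single i₂ (l i₂) i +ᴿ single i₃ (l i₃) i)

    ∑-saving : ∑ saving ≡ P +ᴿ (l i₂ +ᴿ l i₃)
    ∑-saving = begin
      ∑ saving
        ≡⟨ ∑-distrib-+ (λ i → onlyIf (isDesc (suc i) v) (l i)) (λ i → single i₂ (l i₂) i +ᴿ single i₃ (l i₃) i) ⟩
      P +ᴿ ∑ (λ i → single i₂ (l i₂) i +ᴿ single i₃ (l i₃) i)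
        ≡⟨ cong (P +ᴿ_) (∑-distrib-+ (single i₂ (l i₂)) (single i₃ (l i₃))) ⟩
      P +ᴿ (∑ (single i₂ (l i₂)) +ᴿ ∑ (single i₃ (l i₃)))
        ≡⟨ cong (P +ᴿ_) (cong₂ _+ᴿ_ (∑-single i₂ (l i₂)) (∑-single i₃ (l i₃))) ⟩
      P +ᴿ (l i₂ +ᴿ l i₃)
        ∎
      where open ≡-Reasoning

    saving-cases : ∀ i → (saving i ≡ l i × suc (traffic residual i) ℕ.≤ traffic d i)
                       ⊎ (saving i ≡ 0ᴿ × traffic residual i ℕ.≤ traffic d i)
    saving-cases i = byCases (isDesc (suc i) v) refl (i ≟ i₂) (i ≟ i₃)
      where
      saving≡ : ∀ {a b c} → onlyIf (isDesc (suc i) v) (l i) ≡ a → single i₂ (l i₂) i ≡ b → single i₃ (l i₃) i ≡ c →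
                saving i ≡ a +ᴿ (b +ᴿ c)
      saving≡ a≡ b≡ c≡ = cong₂ _+ᴿ_ a≡ (cong₂ _+ᴿ_ b≡ c≡)
      onPath≡ : ∀ {b} → isDesc (suc i) v ≡ b → onlyIf (isDesc (suc i) v) (l i) ≡ onlyIf b (l i)
      onPath≡ = cong (λ b → onlyIf b (l i))
      byCases : ∀ b → isDesc (suc i) v ≡ b → Dec (i ≡ i₂) → Dec (i ≡ i₃) →
                (saving i ≡ l i × suc (traffic residual i) ℕ.≤ traffic d i)
                ⊎ (saving i ≡ 0ᴿ × traffic residual i ℕ.≤ traffic d i)
      byCases true v∈Ti _ _ =
        inj₁ (trans (saving≡ (onPath≡ v∈Ti) (single-≢ (l i₂) (notLeafEdge par₂)) (single-≢ (l i₃) (notLeafEdge par₃)))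
                    (trans (cong (l i +ᴿ_) (+-identityˡ 0ᴿ)) (+-identityʳ (l i)))
             , traffic-drop-onPath i v∈Ti)
        where
        notLeafEdge : ∀ {k} → par k ≡ v → ¬ i ≡ k
        notLeafEdge refl refl with () ← trans (sym v∈Ti) (isDesc-par i)
      byCases false v∉Ti (yes refl) _ =
        inj₁ (trans (saving≡ (onPath≡ v∉Ti) (single-≡ i₂ (l i₂)) (single-≢ (l i₃) i₂≢i₃))
                    (trans (+-identityˡ _) (+-identityʳ (l i₂)))
             , traffic-drop-leaf leaf₂ (proj₁ d₂) served-w₂)
      byCases false v∉Ti (no i≢i₂) (yes refl) =
        inj₁ (trans (saving≡ (onPath≡ v∉Ti) (single-≢ (l i₂) i≢i₂) (single-≡ i₃ (l i₃)))
                    (trans (+-identityˡ _) (+-identityˡ (l i₃)))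
             , traffic-drop-leaf leaf₃ (proj₁ d₃) served-w₃)
      byCases false v∉Ti (no i≢i₂) (no i≢i₃) =
        inj₂ (trans (saving≡ (onPath≡ v∉Ti) (single-≢ (l i₂) i≢i₂) (single-≢ (l i₃) i≢i₃))
                    (trans (+-identityˡ _) (+-identityˡ 0ᴿ))
             , traffic-residual-≤ i)

    LB-drop : LB l residual +ᴿ (∑ saving +ᴿ ∑ saving) ≤ᴿ LB l d
    LB-drop = ≤-resp₂ distribute refl (∑-mono λ i → edge-term-drop (0≤l i) (saving-cases i))
      where
      distribute : ∑ (λ i → (ι 2 *ᴿ l i) *ᴿ ι (traffic residual i) +ᴿ (saving i +ᴿ saving i)) ≡
                   LB l residual +ᴿ (∑ saving +ᴿ ∑ saving)
      distribute = trans (∑-distrib-+ (λ i → (ι 2 *ᴿ l i) *ᴿ ι (traffic residual i)) (λ i → saving i +ᴿ saving i))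
                         (cong (LB l residual +ᴿ_) (∑-distrib-+ saving saving))

    totalLen-tours : totalLen l tours ≡ ((l i₂ +ᴿ P) +ᴿ (l i₂ +ᴿ P)) +ᴿ ((l i₃ +ᴿ P) +ᴿ (l i₃ +ᴿ P))
    totalLen-tours = cong₂ _+ᴿ_ (walkLen-roundTrip-child par₂) (trans (+-identityʳ _) (walkLen-roundTrip-child par₃))
      where
      walkLen-roundTrip-child : ∀ {j} → par j ≡ v → walkLen l (roundTrip (suc j)) ≡ (l j +ᴿ P) +ᴿ (l j +ᴿ P)
      walkLen-roundTrip-child {j} refl = trans (walkLen-roundTrip l (suc j)) (cong (λ x → x +ᴿ x) (pathLen-suc l j))

    approx : P ≤ᴿ l i₂ → P ≤ᴿ l i₃ → Approx43 l d tours
    approx P≤l₂ P≤l₃ = (λ ()) , served≤d , ≤-<-trans 0≤1 1<∑served , bound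
      where
      open ≤-Reasoning
      bound : ι 3 *ᴿ totalLen l tours ≤ᴿ ι 4 *ᴿ (LB l d -ᴿ LB l residual)
      bound = begin
        ι 3 *ᴿ totalLen l tours                                          ≡⟨ ι*≡× 3 (totalLen l tours) ⟩
        3 ×ᴿ totalLen l tours                                            ≡⟨ cong (3 ×ᴿ_) totalLen-tours ⟩
        3 ×ᴿ (((l i₂ +ᴿ P) +ᴿ (l i₂ +ᴿ P)) +ᴿ ((l i₃ +ᴿ P) +ᴿ (l i₃ +ᴿ P)))  ≤⟨ 3[2[a+P]+2[b+P]]≤4[2[P+a+b]] P≤l₂ P≤l₃ ⟩
        4 ×ᴿ ((P +ᴿ (l i₂ +ᴿ l i₃)) +ᴿ (P +ᴿ (l i₂ +ᴿ l i₃)))             ≡⟨ cong (λ g → 4 ×ᴿ (g +ᴿ g)) ∑-saving ⟨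
        4 ×ᴿ (∑ saving +ᴿ ∑ saving)                                      ≤⟨ ×ᴿ-monoʳ 4 (x+y≤z⇒y≤z-x LB-drop) ⟩
        4 ×ᴿ (LB l d -ᴿ LB l residual)                                   ≡⟨ ι*≡× 4 _ ⟨
        ι 4 *ᴿ (LB l d -ᴿ LB l residual)                                 ∎

    served-below : ∀ u → ¬ served u ≡ 0ᴿ → isDesc v u ≡ true
    served-below u served≢0 = byCases (u ≟ w₂) (u ≟ w₃)
      where
      byCases : Dec (u ≡ w₂) → Dec (u ≡ w₃) → isDesc v u ≡ true
      byCases (yes refl) _ = isDesc-child i₂ par₂ (isDesc-refl v)
      byCases (no _) (yes refl) = isDesc-child i₃ par₃ (isDesc-refl v)
      byCases (no u≢w₂) (no u≢w₃) = ⊥-elim (served≢0 (served-elsewhere u≢w₂ u≢w₃))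

lemma9 : (F : CompleteOrderedField) → let open CompleteOrderedField F in
         (n : ℕ) (par : Fin n → Fin (suc n)) → (∀ i → toℕ (par i) ≤ toℕ i) →
         let open Inst F n par in
         (l : Fin n → R) (d : V → R) → (∀ i → 0ᴿ ≤ᴿ l i) → (∀ v → 0ᴿ ≤ᴿ d v) →
         (p : ℕ) → 3 ≤ p → (e : Fin n) → ShortChain l d p e → Admits l d e
lemma9 F zero par par<child l d 0≤l 0≤d _ _ ()
lemma9 F (suc n) par par<child l d 0≤l 0≤d (suc (suc (suc q))) _ e
  (simplified , _ , _ , i₂ , i₃ , (_ , _ , i₂≢i₃ , _ , par₂ , par₃ , _) , leaf₂ , leaf₃ , 1<d₂+d₃ , _ , _ , P≤l₂ , P≤l₃) =
  tours , approx P≤l₂ P≤l₃ , served-below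
  where
  open CompleteOrderedField F
  open Inst F (suc n) par
  open TreeProperties F n par par<child
  leaf-demand : ∀ {j} → par j ≡ suc e → Leaf (suc j) → (0ᴿ <ᴿ d (suc j)) × (d (suc j) <ᴿ 1ᴿ)
  leaf-demand {j} par[j]≡suc[e] leaf =
    Simplified.leaf-demand simplified (suc j) (isDesc-child j par[j]≡suc[e] (isDesc-refl (suc e))) leaf
  open TwoLeafTours l d 0≤l 0≤d i₂≢i₃ par₂ par₃ leaf₂ leaf₃ (leaf-demand par₂ leaf₂) (leaf-demand par₃ leaf₃) 1<d₂+d₃
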